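{- Let $G$ be a connected finite simple graph on $n\geq 4$ vertices that is not isomorphic to the path $P_4$, and suppose that $G-L(G)$ is identifiable or $G$ is triangle-free. Then $G$ admits a total dominating identifying code, and $\gamma_t^{\mathrm{ID}}(G)\leq n-s(G)$.
   Context: All graphs are finite, simple and undirected. A leaf is a vertex of degree $1$; a support vertex is a vertex adjacent to a leaf. $L(G)$ denotes the set of leaves of $G$, $s(G)$ the number of support vertices, and $G-L(G)$ the graph obtained from $G$ by deleting all leaves. $N[v]$ denotes the closed neighbourhood of $v$. A set $C\subseteq V(G)$ is an identifying code if for every vertex $v$ the set $N[v]\cap C$ is nonempty and for every two distinct vertices $u,v$ we have $N[u]\cap C\neq N[v]\cap C$. A graph is identifiable if it admits an identifying code, equivalently if no two distinct vertices have the same closed neighbourhood. A total dominating identifying code is an identifying code $C$ such that every vertex of $G$ has a neighbour in $C$; $\gamma_t^{\mathrm{ID}}(G)$ is the minimum size of a total dominating identifying code of $G$. -}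

module Defs where

open import Data.Nat using (ℕ; zero; suc; _+_; _∸_; _≡ᵇ_)
open import Data.Bool using (Bool; true; false; _∧_; _∨_; if_then_else_)
open import Data.Fin using (Fin; zero; suc)
open import Data.Fin.Subset using (Subset; _∈_)
open import Data.Sum using (_⊎_)
open import Data.Product using (Σ; ∃; ∃-syntax; _×_; _,_)
open import Relation.Nullary using (¬_)
open import Relation.Binary.PropositionalEquality using (_≡_; _≢_)
open import Function.Bundles using (_⇔_; _⤖_; Bijection)

count : ∀ {m} → (Fin m → Bool) → ℕ
count {zero}  p = 0
count {suc m} p = (if p zero then 1 else 0) + count (λ i → p (suc i))

anyFin : ∀ {m} → (Fin m → Bool) → Bool
anyFin {zero}  p = false
anyFin {suc m} p = p zero ∨ anyFin (λ i → p (suc i))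

record Graph (n : ℕ) : Set where
  field
    adj    : Fin n → Fin n → Bool
    sym    : ∀ u v → adj u v ≡ adj v u
    irrefl : ∀ v → adj v v ≡ false
open Graph public

module _ {n : ℕ} (G : Graph n) where

  Adj : Fin n → Fin n → Set
  Adj u v = adj G u v ≡ true

  degree : Fin n → ℕ
  degree v = count (adj G v)

  isLeaf : Fin n → Bool
  isLeaf v = degree v ≡ᵇ 1

  isSupport : Fin n → Bool
  isSupport v = anyFin (λ w → adj G v w ∧ isLeaf w)

  s : ℕ
  s = count isSupport

  InN : Fin n → Fin n → Set
  InN v u = (u ≡ v) ⊎ Adj v u

  data Reach : Fin n → Fin n → Set where
    here : ∀ {u} → Reach u u
    step : ∀ {u v w} → Adj u v → Reach v w → Reach u w

  Connected : Set
  Connected = ∀ u v → Reach u v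

  TriangleFree : Set
  TriangleFree = ¬ (∃[ u ] ∃[ v ] ∃[ w ] (Adj u v × Adj v w × Adj u w))

  Identifiable : Set
  Identifiable = ∀ u v → u ≢ v → ¬ (∀ w → InN u w ⇔ InN v w)

  -- G - L(G) is identifiable.  G - L(G) is the subgraph induced by the
  -- non-leaves of G; its closed neighbourhoods are those of G intersected
  -- with the set of non-leaves.
  NonLeaf : Fin n → Set
  NonLeaf v = isLeaf v ≡ false

  IdentifiableMinusLeaves : Set
  IdentifiableMinusLeaves =
    ∀ u v → NonLeaf u → NonLeaf v → u ≢ v →
      ¬ (∀ w → NonLeaf w → (InN u w ⇔ InN v w))

  IdentifyingCode : Subset n → Set
  IdentifyingCode C =
    (∀ v → ∃[ u ] (u ∈ C × InN v u)) ×
    (∀ u v → u ≢ v → ¬ (∀ w → w ∈ C → (InN u w ⇔ InN v w)))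

  TDIDCode : Subset n → Set
  TDIDCode C = IdentifyingCode C × (∀ v → ∃[ u ] (u ∈ C × Adj v u))

p4adj : Fin 4 → Fin 4 → Bool
p4adj zero (suc zero) = true
p4adj (suc zero) zero = true
p4adj (suc zero) (suc (suc zero)) = true
p4adj (suc (suc zero)) (suc zero) = true
p4adj (suc (suc zero)) (suc (suc (suc zero))) = true
p4adj (suc (suc (suc zero))) (suc (suc zero)) = true
p4adj _ _ = false

IsoP4 : ∀ {n} → Graph n → Set
IsoP4 {n} G = Σ (Fin n ⤖ Fin 4) λ f →
  ∀ u v → adj G u v ≡ p4adj (Bijection.to f u) (Bijection.to f v)

module Submission where

-- Take C to be V(G) minus one leaf at each support vertex, so ∣C∣ = n − s(G). C is totally
-- dominating: a leaf's neighbour is not a leaf (G is connected with n ≥ 3), and a non-leaf cannot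
-- have only removed neighbours, since at most one removed leaf hangs at each vertex. A removed leaf u
-- with support x is the only vertex whose closed neighbourhood meets C in exactly {x}. Two vertices
-- u, v of C with the same trace on C are adjacent, and either hypothesis forces every other neighbour
-- of u and of v to be a removed leaf; by connectivity and n ≥ 4 the graph is then the path P4.

open import Defs renaming (sym to adj-sym)
open import Data.Nat using (ℕ; zero; suc; _≤_; _∸_; z≤n; s≤s)
open import Data.Nat.Properties
  using (suc-injective; 0≢1+n; ≡ᵇ⇒≡; ≡⇒≡ᵇ; <⇒≱; ≤-trans; n≤1+n; ≤-reflexive; ∸-monoʳ-≤)
open import Data.Bool using (Bool; true; false; _∧_; if_then_else_)
open import Data.Bool.Properties using (¬-not; not-¬; T-≡)
import Data.Bool.Properties as Bool
open import Data.Fin using (Fin; zero; suc; _≟_)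
open import Data.Fin.Patterns using (0F; 1F; 2F; 3F)
open import Data.Fin.Properties using (any?; injective⇒≤)
import Data.Fin.Properties as Fin
open import Data.Fin.Subset using (Subset; ∣_∣; _∈_; _∉_; ∁)
open import Data.Fin.Subset.Properties using (_∈?_; x∈∁p⇒x∉p; x∉p⇒x∈∁p; x∉∁p⇒x∈p; ∣∁p∣≡n∸∣p∣)
open import Data.Vec using (Vec; []; _∷_; lookup; tabulate)
open import Data.Vec.Properties using (lookup∘tabulate; []=⇒lookup)
open import Data.Vec.Membership.Propositional using () renaming (_∈_ to _∈ᵥ_)
open import Data.Vec.Relation.Unary.Any using (here; there; index)
open import Data.Vec.Relation.Unary.Any.Properties using (lookup-index)
open import Data.Product using (∃-syntax; _×_; _,_; proj₁; proj₂)
import Data.Product as Product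
open import Data.Sum using (_⊎_; inj₁; inj₂; [_,_])
import Data.Sum as Sum
open import Data.Empty using (⊥; ⊥-elim)
open import Function using (_∘_; id; case_of_)
open import Function.Bundles using (_⇔_; Equivalence; mk↔ₛ′)
open import Function.Definitions using (Injective; StrictlySurjective)
open import Function.Properties.Equivalence using () renaming (sym to ⇔-sym)
open import Function.Properties.Inverse using (↔⇒⤖)
open import Relation.Nullary using (¬_; Dec; yes; no; does; contradiction)
open import Relation.Nullary.Decidable using (_×-dec_; dec-true)
open import Relation.Unary using (Pred; Decidable)
open import Level using (0ℓ)
open import Relation.Binary.PropositionalEquality
  using (_≡_; _≢_; refl; sym; trans; cong; cong₂; subst)

-- Defined by cases on i ≟ a rather than with _∧_, so that (p - suc a) ∘ suc is
-- definitionally (p ∘ suc) - a.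
_-_ : ∀ {m} → (Fin m → Bool) → Fin m → Fin m → Bool
(p - a) i = if does (i ≟ a) then false else p i

-≢ : ∀ {m} (p : Fin m → Bool) {a i} → i ≢ a → (p - a) i ≡ p i
-≢ p {a} {i} i≢a with i ≟ a
... | yes i≡a = contradiction i≡a i≢a
... | no _ = refl

count-remove : ∀ {m} (p : Fin m → Bool) {a} → p a ≡ true → count p ≡ suc (count (p - a))
count-remove {suc m} p {zero} pa rewrite pa = refl
count-remove {suc m} p {suc a} pa with p zero
... | true = cong suc (count-remove (p ∘ suc) pa)
... | false = count-remove (p ∘ suc) pa

count-zero : ∀ {m} (p : Fin m → Bool) → (∀ i → p i ≡ false) → count p ≡ 0
count-zero {zero} p _ = refl
count-zero {suc m} p none rewrite none zero = count-zero (p ∘ suc) (none ∘ suc)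

count≡1⇒unique : ∀ {m} (p : Fin m → Bool) → count p ≡ 1 →
                 ∀ {a b} → p a ≡ true → p b ≡ true → a ≡ b
count≡1⇒unique p one {a} {b} pa pb with b ≟ a
... | yes b≡a = sym b≡a
... | no b≢a = contradiction (trans rest≡0 (count-remove (p - a) (trans (-≢ p b≢a) pb))) 0≢1+n
  where
  rest≡0 : 0 ≡ count (p - a)
  rest≡0 = suc-injective (trans (sym one) (count-remove p pa))

unique⇒count≡1 : ∀ {m} (p : Fin m → Bool) {a} → p a ≡ true →
                 (∀ {b} → p b ≡ true → b ≡ a) → count p ≡ 1
unique⇒count≡1 p {a} pa unique = trans (count-remove p pa) (cong suc (count-zero (p - a) only-a))
  where
  only-a : ∀ i → (p - a) i ≡ false
  only-a i with i ≟ a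
  ... | yes _ = refl
  ... | no i≢a = ¬-not (i≢a ∘ unique)

count-≤-injection : ∀ {m k} (p : Fin m → Bool) (q : Fin k → Bool) (f : Fin m → Fin k) →
                    (∀ {x} → p x ≡ true → q (f x) ≡ true) →
                    (∀ {x y} → p x ≡ true → p y ≡ true → f x ≡ f y → x ≡ y) →
                    count p ≤ count q
count-≤-injection {zero} _ _ _ _ _ = z≤n
count-≤-injection {suc m} p q f into inj with p zero in p0
... | false = count-≤-injection (p ∘ suc) q (f ∘ suc) into (λ px py → Fin.suc-injective ∘ inj px py)
... | true rewrite count-remove q (into p0) =
  s≤s (count-≤-injection (p ∘ suc) (q - f zero) (f ∘ suc) into-rest
        (λ px py → Fin.suc-injective ∘ inj px py))
  where
  into-rest : ∀ {x} → p (suc x) ≡ true → (q - f zero) (f (suc x)) ≡ true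
  into-rest px = trans (-≢ q (Fin.0≢1+n ∘ sym ∘ inj px p0)) (into px)

∣tabulate∣≡count : ∀ {m} (p : Fin m → Bool) → ∣ tabulate p ∣ ≡ count p
∣tabulate∣≡count {zero} p = refl
∣tabulate∣≡count {suc m} p with p zero
... | true = cong suc (∣tabulate∣≡count (p ∘ suc))
... | false = ∣tabulate∣≡count (p ∘ suc)

anyFin⇒∃ : ∀ {m} (p : Fin m → Bool) → anyFin p ≡ true → ∃[ i ] (p i ≡ true)
anyFin⇒∃ {suc m} p some with p zero in p0
... | true = zero , p0
... | false = Product.map suc id (anyFin⇒∃ (p ∘ suc) some)

∧≡true⁻ : ∀ {a b} → a ∧ b ≡ true → a ≡ true × b ≡ true
∧≡true⁻ {true} {true} _ = refl , refl

module _ {m : ℕ} {P : Pred (Fin m) 0ℓ} (P? : Decidable P) where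

  subset : Subset m
  subset = tabulate (does ∘ P?)

  ∈-subset⁻ : ∀ {i} → i ∈ subset → P i
  ∈-subset⁻ {i} i∈ with P? i | trans (sym (lookup∘tabulate (does ∘ P?) i)) ([]=⇒lookup i∈)
  ... | yes pi | _ = pi

surjective⇒≤ : ∀ {m n} {f : Fin m → Fin n} → StrictlySurjective _≡_ f → n ≤ m
surjective⇒≤ {f = f} surj = injective⇒≤ section-injective
  where
  section-injective : Injective _≡_ _≡_ (proj₁ ∘ surj)
  section-injective {x} {y} eq = trans (sym (proj₂ (surj x))) (trans (cong f eq) (proj₂ (surj y)))

covering⇒surjective : ∀ {k n} {xs : Vec (Fin n) k} → (∀ w → w ∈ᵥ xs) → StrictlySurjective _≡_ (lookup xs)
covering⇒surjective cover w = index (cover w) , sym (lookup-index (cover w))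

another-vertex : ∀ {n} → 2 ≤ n → (v : Fin n) → ∃[ w ] (w ≢ v)
another-vertex (s≤s (s≤s _)) zero = 1F , λ ()
another-vertex (s≤s (s≤s _)) (suc v) = 0F , λ ()

p4adj-injective : ∀ i j → (∀ k → p4adj i k ≡ p4adj j k) → i ≡ j
p4adj-injective 0F 0F _ = refl
p4adj-injective 0F 1F same = contradiction (same 0F) λ ()
p4adj-injective 0F 2F same = contradiction (same 3F) λ ()
p4adj-injective 0F 3F same = contradiction (same 1F) λ ()
p4adj-injective 1F 0F same = contradiction (same 0F) λ ()
p4adj-injective 1F 1F _ = refl
p4adj-injective 1F 2F same = contradiction (same 0F) λ ()
p4adj-injective 1F 3F same = contradiction (same 0F) λ ()
p4adj-injective 2F 0F same = contradiction (same 3F) λ ()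
p4adj-injective 2F 1F same = contradiction (same 0F) λ ()
p4adj-injective 2F 2F _ = refl
p4adj-injective 2F 3F same = contradiction (same 1F) λ ()
p4adj-injective 3F 0F same = contradiction (same 1F) λ ()
p4adj-injective 3F 1F same = contradiction (same 0F) λ ()
p4adj-injective 3F 2F same = contradiction (same 1F) λ ()
p4adj-injective 3F 3F _ = refl

module _ {n : ℕ} (G : Graph n) where

  Leaf : Fin n → Set
  Leaf v = isLeaf G v ≡ true

  Adj? : ∀ u v → Dec (Adj G u v)
  Adj? u v = adj G u v Bool.≟ true

  Adj-sym : ∀ {u v} → Adj G u v → Adj G v u
  Adj-sym {u} {v} = trans (adj-sym G v u)

  Adj-irrefl : ∀ {v} → ¬ Adj G v v
  Adj-irrefl {v} vv = case trans (sym vv) (irrefl G v) of λ ()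

  leaf-unique-neighbour : ∀ {ℓ a b} → Leaf ℓ → Adj G ℓ a → Adj G ℓ b → a ≡ b
  leaf-unique-neighbour {ℓ} leaf =
    count≡1⇒unique (adj G ℓ) (≡ᵇ⇒≡ (degree G ℓ) 1 (Equivalence.from T-≡ leaf))

  unique-neighbour⇒leaf : ∀ {v a} → Adj G v a → (∀ {b} → Adj G v b → b ≡ a) → Leaf v
  unique-neighbour⇒leaf {v} va unique =
    Equivalence.to T-≡ (≡⇒≡ᵇ (degree G v) 1 (unique⇒count≡1 (adj G v) va unique))

  connected-closure : Connected G → (P : Fin n → Set) → (∀ {x y} → P x → Adj G x y → P y) →
                      ∀ {u} → P u → ∀ w → P w
  connected-closure conn P closed {u} pu w = along (conn u w) pu
    where
    along : ∀ {x y} → Reach G x y → P x → P y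
    along here px = px
    along (step xz zy) px = along zy (closed px xz)

  connected⇒neighbour : Connected G → 2 ≤ n → ∀ v → ∃[ u ] Adj G v u
  connected⇒neighbour conn 2≤n v = first-step (conn v w) w≢v
    where
    w = proj₁ (another-vertex 2≤n v)
    w≢v = proj₂ (another-vertex 2≤n v)
    first-step : ∀ {w} → Reach G v w → w ≢ v → ∃[ u ] Adj G v u
    first-step here w≢v = contradiction refl w≢v
    first-step (step vu _) _ = _ , vu

  -- Otherwise the edge between two leaves would be a whole component.
  leaf-neighbour-nonLeaf : Connected G → 3 ≤ n → ∀ {ℓ x} → Leaf ℓ → Adj G ℓ x → NonLeaf G x
  leaf-neighbour-nonLeaf conn 3≤n {ℓ} {x} leafℓ ℓx = ¬-not λ leafx →
    <⇒≱ 3≤n (surjective⇒≤ (covering⇒surjective (connected-closure conn _ (closed leafx) (here refl))))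
    where
    closed : Leaf x → ∀ {y z} → y ∈ᵥ ℓ ∷ x ∷ [] → Adj G y z → z ∈ᵥ ℓ ∷ x ∷ []
    closed _ (here refl) ℓz = there (here (leaf-unique-neighbour leafℓ ℓz ℓx))
    closed leafx (there (here refl)) xz = here (leaf-unique-neighbour leafx xz (Adj-sym ℓx))

  induced-P4⇒IsoP4 : (f : Fin 4 → Fin n) → StrictlySurjective _≡_ f →
                     (∀ i j → adj G (f i) (f j) ≡ p4adj i j) → IsoP4 G
  induced-P4⇒IsoP4 f surj f-adj = ↔⇒⤖ (mk↔ₛ′ to f to∘f f∘to) , to-adj
    where
    to : Fin n → Fin 4
    to w = proj₁ (surj w)
    f∘to : ∀ w → f (to w) ≡ w
    f∘to w = proj₂ (surj w)
    f-injective : ∀ {i j} → f i ≡ f j → i ≡ j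
    f-injective {i} {j} fi≡fj = p4adj-injective i j λ k →
      trans (sym (f-adj i k)) (trans (cong (λ x → adj G x (f k)) fi≡fj) (f-adj j k))
    to∘f : ∀ i → to (f i) ≡ i
    to∘f i = f-injective (f∘to (f i))
    to-adj : ∀ u v → adj G u v ≡ p4adj (to u) (to v)
    to-adj u v = trans (cong₂ (adj G) (sym (f∘to u)) (sym (f∘to v))) (f-adj (to u) (to v))

  covering-path⇒IsoP4 : ∀ {a b c d} → (∀ w → w ∈ᵥ a ∷ b ∷ c ∷ d ∷ []) →
                        Adj G a b → Adj G b c → Adj G c d →
                        ¬ Adj G a c → ¬ Adj G a d → ¬ Adj G b d → IsoP4 G
  covering-path⇒IsoP4 {a} {b} {c} {d} cover ab bc cd ¬ac ¬ad ¬bd =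
    induced-P4⇒IsoP4 (lookup path) (covering⇒surjective cover) path-adj
    where
    path : Vec (Fin n) 4
    path = a ∷ b ∷ c ∷ d ∷ []
    path-adj : ∀ i j → adj G (lookup path i) (lookup path j) ≡ p4adj i j
    path-adj 0F 0F = irrefl G a
    path-adj 0F 1F = ab
    path-adj 0F 2F = ¬-not ¬ac
    path-adj 0F 3F = ¬-not ¬ad
    path-adj 1F 0F = Adj-sym ab
    path-adj 1F 1F = irrefl G b
    path-adj 1F 2F = bc
    path-adj 1F 3F = ¬-not ¬bd
    path-adj 2F 0F = ¬-not (¬ac ∘ Adj-sym)
    path-adj 2F 1F = Adj-sym bc
    path-adj 2F 2F = irrefl G c
    path-adj 2F 3F = cd
    path-adj 3F 0F = ¬-not (¬ad ∘ Adj-sym)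
    path-adj 3F 1F = ¬-not (¬bd ∘ Adj-sym)
    path-adj 3F 2F = Adj-sym cd
    path-adj 3F 3F = irrefl G d

  record LeafSelection : Set where
    field
      selected : Subset n
      selected⇒leaf : ∀ {ℓ} → ℓ ∈ selected → Leaf ℓ
      one-per-support : ∀ {x ℓ ℓ′} → ℓ ∈ selected → ℓ′ ∈ selected → Adj G x ℓ → Adj G x ℓ′ → ℓ ≡ ℓ′

  private
    leafNeighbour? : ∀ v → Dec (∃[ ℓ ] (Adj G v ℓ × Leaf ℓ))
    leafNeighbour? v = any? λ ℓ → Adj? v ℓ ×-dec (isLeaf G ℓ Bool.≟ true)

    chooseLeaf : ∀ {v} → Dec (∃[ ℓ ] (Adj G v ℓ × Leaf ℓ)) → Fin n
    chooseLeaf (yes (ℓ , _)) = ℓ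
    chooseLeaf {v} (no _) = v

    chooseLeaf-spec : ∀ {v} (found : Dec (∃[ ℓ ] (Adj G v ℓ × Leaf ℓ))) → isSupport G v ≡ true →
                      Adj G v (chooseLeaf found) × Leaf (chooseLeaf found)
    chooseLeaf-spec (yes (_ , vℓ , leafℓ)) _ = vℓ , leafℓ
    chooseLeaf-spec {v} (no none) supp =
      contradiction (Product.map₂ ∧≡true⁻ (anyFin⇒∃ (λ w → adj G v w ∧ isLeaf G w) supp)) none

  leafOf : Fin n → Fin n
  leafOf v = chooseLeaf (leafNeighbour? v)

  leafOf-spec : ∀ {v} → isSupport G v ≡ true → Adj G v (leafOf v) × Leaf (leafOf v)
  leafOf-spec = chooseLeaf-spec (leafNeighbour? _)

  leafOf-injective : ∀ {x y} → isSupport G x ≡ true → isSupport G y ≡ true → leafOf x ≡ leafOf y → x ≡ y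
  leafOf-injective suppx suppy same with xℓ , leafℓ ← leafOf-spec suppx | yℓ′ ← proj₁ (leafOf-spec suppy) =
    leaf-unique-neighbour leafℓ (Adj-sym xℓ) (Adj-sym (subst (Adj G _) (sym same) yℓ′))

  ChosenLeaf : Fin n → Set
  ChosenLeaf ℓ = ∃[ v ] (isSupport G v ≡ true × leafOf v ≡ ℓ)

  ChosenLeaf? : Decidable ChosenLeaf
  ChosenLeaf? ℓ = any? λ v → (isSupport G v Bool.≟ true) ×-dec (leafOf v ≟ ℓ)

  chosenLeaf⇒leaf : ∀ {ℓ} → ChosenLeaf ℓ → Leaf ℓ
  chosenLeaf⇒leaf (_ , supp , refl) = proj₂ (leafOf-spec supp)

  chosenLeaf-of-neighbour : ∀ {x ℓ} → ChosenLeaf ℓ → Adj G x ℓ → ℓ ≡ leafOf x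
  chosenLeaf-of-neighbour (v , supp , refl) xℓ
    with vℓ , leafℓ ← leafOf-spec supp
    rewrite leaf-unique-neighbour leafℓ (Adj-sym xℓ) (Adj-sym vℓ) = refl

  chosenLeaves : LeafSelection
  chosenLeaves = record
    { selected = subset ChosenLeaf?
    ; selected⇒leaf = chosenLeaf⇒leaf ∘ ∈-subset⁻ ChosenLeaf?
    ; one-per-support = λ ℓ∈ ℓ′∈ xℓ xℓ′ →
        trans (chosenLeaf-of-neighbour (∈-subset⁻ ChosenLeaf? ℓ∈) xℓ)
              (sym (chosenLeaf-of-neighbour (∈-subset⁻ ChosenLeaf? ℓ′∈) xℓ′))
    }

  s≤∣chosenLeaves∣ : s G ≤ ∣ LeafSelection.selected chosenLeaves ∣
  s≤∣chosenLeaves∣ = subst (s G ≤_) (sym (∣tabulate∣≡count (does ∘ ChosenLeaf?)))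
    (count-≤-injection (isSupport G) (does ∘ ChosenLeaf?) leafOf
      (λ {v} supp → dec-true (ChosenLeaf? (leafOf v)) (v , supp , refl))
      leafOf-injective)

  Indistinguishable : Subset n → Fin n → Fin n → Set
  Indistinguishable C u v = ∀ w → w ∈ C → (InN G u w ⇔ InN G v w)

  Indistinguishable-sym : ∀ {C u v} → Indistinguishable C u v → Indistinguishable C v u
  Indistinguishable-sym I w w∈C = ⇔-sym (I w w∈C)

  module LeafComplement (conn : Connected G) (4≤n : 4 ≤ n) (S : LeafSelection) where

    open LeafSelection S public

    C : Subset n
    C = ∁ selected

    OnlyCNeighbour : Fin n → Fin n → Set
    OnlyCNeighbour u v = ∀ {w} → Adj G u w → w ∈ C → w ≡ v

    SelectedNeighbour : Fin n → Fin n → Set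
    SelectedNeighbour x ℓ = ℓ ∈ selected × Adj G x ℓ

    selectedNeighbour-unique : ∀ {x ℓ ℓ′} → SelectedNeighbour x ℓ → SelectedNeighbour x ℓ′ → ℓ ≡ ℓ′
    selectedNeighbour-unique (ℓ∈ , xℓ) (ℓ′∈ , xℓ′) = one-per-support ℓ∈ ℓ′∈ xℓ xℓ′

    C-or-selected : ∀ w → w ∈ C ⊎ w ∈ selected
    C-or-selected w with w ∈? selected
    ... | yes w∈ = inj₂ w∈
    ... | no w∉ = inj₁ (x∉p⇒x∈∁p w∉)

    nonLeaf∈C : ∀ {w} → NonLeaf G w → w ∈ C
    nonLeaf∈C nonLeaf = x∉p⇒x∈∁p (not-¬ nonLeaf ∘ selected⇒leaf)

    3≤n : 3 ≤ n
    3≤n = ≤-trans (n≤1+n 3) 4≤n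

    neighbour : ∀ v → ∃[ u ] Adj G v u
    neighbour = connected⇒neighbour conn (≤-trans (n≤1+n 2) 3≤n)

    support∈C : ∀ {ℓ x} → Leaf ℓ → Adj G ℓ x → x ∈ C
    support∈C leafℓ ℓx = nonLeaf∈C (leaf-neighbour-nonLeaf conn 3≤n leafℓ ℓx)

    -- A vertex with no neighbour in C has only selected neighbours, hence just one: it is a leaf.
    C-total-domination : ∀ v → ∃[ u ] (u ∈ C × Adj G v u)
    C-total-domination v with any? (λ u → (u ∈? C) ×-dec Adj? v u)
    ... | yes found = found
    ... | no none = u , support∈C (unique-neighbour⇒leaf vu only-u) vu , vu
      where
      u = proj₁ (neighbour v)
      vu = proj₂ (neighbour v)
      selected-neighbour : ∀ {w} → Adj G v w → w ∈ selected
      selected-neighbour vw = x∉∁p⇒x∈p λ w∈C → none (_ , w∈C , vw)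
      only-u : ∀ {w} → Adj G v w → w ≡ u
      only-u vw = one-per-support (selected-neighbour vw) (selected-neighbour vu) vw vu

    selected-distinguished : ∀ {u v} → u ∈ selected → u ≢ v → ¬ Indistinguishable C u v
    selected-distinguished {u} {v} u∈ u≢v I = [ v∈C-impossible , v∈selected-impossible ] (C-or-selected v)
      where
      x = proj₁ (neighbour u)
      ux = proj₂ (neighbour u)
      trace-u : ∀ {w} → w ∈ C → InN G u w → w ≡ x
      trace-u w∈C (inj₁ refl) = contradiction u∈ (x∈∁p⇒x∉p w∈C)
      trace-u w∈C (inj₂ uw) = leaf-unique-neighbour (selected⇒leaf u∈) uw ux
      trace-v : ∀ {w} → w ∈ C → InN G v w → w ≡ x
      trace-v w∈C = trace-u w∈C ∘ Equivalence.from (I _ w∈C)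
      vx : Adj G v x
      vx = let y , y∈C , vy = C-total-domination v in subst (Adj G v) (trace-v y∈C (inj₂ vy)) vy
      v∈C-impossible : v ∉ C
      v∈C-impossible v∈C = Adj-irrefl (subst (λ z → Adj G z x) (trace-v v∈C (inj₁ refl)) vx)
      v∈selected-impossible : v ∉ selected
      v∈selected-impossible v∈ = u≢v (one-per-support u∈ v∈ (Adj-sym ux) (Adj-sym vx))

    triangle-free⇒onlyCNeighbour : TriangleFree G → ∀ {u v} → Indistinguishable C u v →
                                   Adj G u v → OnlyCNeighbour u v
    triangle-free⇒onlyCNeighbour triangle-free {u} {v} I uv {w} uw w∈C
      with Equivalence.to (I w w∈C) (inj₂ uw)
    ... | inj₁ w≡v = w≡v
    ... | inj₂ vw = contradiction (u , v , w , uv , vw , uw) triangle-free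

    leaf⇒onlyCNeighbour : ∀ {u v} → Leaf u → Adj G u v → OnlyCNeighbour u v
    leaf⇒onlyCNeighbour leafu uv uw _ = leaf-unique-neighbour leafu uw uv

    twin-of-leaf⇒onlyCNeighbour : ∀ {u v} → Leaf u → Adj G u v → Indistinguishable C u v →
                                  OnlyCNeighbour v u
    twin-of-leaf⇒onlyCNeighbour {u} {v} leafu uv I {w} vw w∈C with Equivalence.from (I w w∈C) (inj₂ vw)
    ... | inj₁ w≡u = w≡u
    ... | inj₂ uw = contradiction (subst (Adj G v) (leaf-unique-neighbour leafu uw uv) vw) Adj-irrefl

    -- Every vertex is u, v or a selected leaf at u or v; with n ≥ 4 both leaves exist and span a P4.
    pendant-edge⇒IsoP4 : ∀ {u v} → u ∈ C → v ∈ C → Adj G u v →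
                         OnlyCNeighbour u v → OnlyCNeighbour v u → IsoP4 G
    pendant-edge⇒IsoP4 {u} {v} u∈C v∈C uv only-u only-v =
      by-selected-neighbours (selectedNeighbour? u) (selectedNeighbour? v)
      where
      u≢v : u ≢ v
      u≢v refl = Adj-irrefl uv

      Near : Fin n → Set
      Near w = SelectedNeighbour u w ⊎ w ≡ u ⊎ w ≡ v ⊎ SelectedNeighbour v w

      leave : ∀ {x z y} → OnlyCNeighbour x z → Adj G x y → y ≡ z ⊎ SelectedNeighbour x y
      leave only xy = Sum.map (only xy) (_, xy) (C-or-selected _)

      closed : ∀ {x y} → Near x → Adj G x y → Near y
      closed (inj₁ (ℓ∈ , uℓ)) ℓy = inj₂ (inj₁ (leaf-unique-neighbour (selected⇒leaf ℓ∈) ℓy (Adj-sym uℓ)))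
      closed (inj₂ (inj₁ refl)) uy = [ inj₂ ∘ inj₂ ∘ inj₁ , inj₁ ] (leave only-u uy)
      closed (inj₂ (inj₂ (inj₁ refl))) vy = [ inj₂ ∘ inj₁ , inj₂ ∘ inj₂ ∘ inj₂ ] (leave only-v vy)
      closed (inj₂ (inj₂ (inj₂ (ℓ∈ , vℓ)))) ℓy =
        inj₂ (inj₂ (inj₁ (leaf-unique-neighbour (selected⇒leaf ℓ∈) ℓy (Adj-sym vℓ))))

      covering : ∀ {k} (xs : Vec (Fin n) k) → (∀ {ℓ} → SelectedNeighbour u ℓ → ℓ ∈ᵥ xs) →
                 u ∈ᵥ xs → v ∈ᵥ xs → (∀ {ℓ} → SelectedNeighbour v ℓ → ℓ ∈ᵥ xs) → ∀ w → w ∈ᵥ xs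
      covering xs at-u u∈ v∈ at-v w =
        [ at-u , [ (λ { refl → u∈ }) , [ (λ { refl → v∈ }) , at-v ] ] ]
          (connected-closure conn Near closed (inj₂ (inj₁ refl)) w)

      ¬covered-by-3 : ∀ {a b c} → ¬ (∀ w → w ∈ᵥ a ∷ b ∷ c ∷ [])
      ¬covered-by-3 cover = <⇒≱ 4≤n (surjective⇒≤ (covering⇒surjective cover))

      selectedNeighbour? : ∀ x → Dec (∃[ ℓ ] SelectedNeighbour x ℓ)
      selectedNeighbour? x = any? λ ℓ → (ℓ ∈? selected) ×-dec Adj? x ℓ

      by-selected-neighbours : Dec (∃[ ℓ ] SelectedNeighbour u ℓ) → Dec (∃[ ℓ ] SelectedNeighbour v ℓ) →
                               IsoP4 G
      by-selected-neighbours (yes (ru , su@(ru∈ , u-ru))) (yes (rv , sv@(rv∈ , v-rv))) =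
        covering-path⇒IsoP4
          (covering (ru ∷ u ∷ v ∷ rv ∷ [])
            (λ s → here (selectedNeighbour-unique s su)) (there (here refl))
            (there (there (here refl))) (λ s → there (there (there (here (selectedNeighbour-unique s sv))))))
          (Adj-sym u-ru) uv v-rv
          (λ ru-v → u≢v (sym (leaf-unique-neighbour (selected⇒leaf ru∈) ru-v (Adj-sym u-ru))))
          (λ ru-rv → x∈∁p⇒x∉p u∈C
            (subst (_∈ selected) (leaf-unique-neighbour (selected⇒leaf ru∈) ru-rv (Adj-sym u-ru)) rv∈))
          (λ u-rv → u≢v (leaf-unique-neighbour (selected⇒leaf rv∈) (Adj-sym u-rv) (Adj-sym v-rv)))
      by-selected-neighbours (yes (ru , su)) (no none-v) = ⊥-elim (¬covered-by-3
        (covering (ru ∷ u ∷ v ∷ []) (λ s → here (selectedNeighbour-unique s su))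
          (there (here refl)) (there (there (here refl))) (λ s → contradiction (_ , s) none-v)))
      by-selected-neighbours (no none-u) (yes (rv , sv)) = ⊥-elim (¬covered-by-3
        (covering (u ∷ v ∷ rv ∷ []) (λ s → contradiction (_ , s) none-u)
          (here refl) (there (here refl)) (λ s → there (there (here (selectedNeighbour-unique s sv))))))
      by-selected-neighbours (no none-u) (no none-v) = ⊥-elim (¬covered-by-3
        (covering (u ∷ v ∷ v ∷ []) (λ s → contradiction (_ , s) none-u)
          (here refl) (there (here refl)) (λ s → contradiction (_ , s) none-v)))

    module _ (hypothesis : IdentifiableMinusLeaves G ⊎ TriangleFree G) (¬P4 : ¬ IsoP4 G) where

      unselected-distinguished : ∀ {u v} → u ∈ C → v ∈ C → u ≢ v → ¬ Indistinguishable C u v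
      unselected-distinguished {u} {v} u∈C v∈C u≢v I with Equivalence.to (I u u∈C) (inj₁ refl)
      ... | inj₁ u≡v = u≢v u≡v
      ... | inj₂ vu = adjacent hypothesis
        where
        uv = Adj-sym vu
        I′ = Indistinguishable-sym I
        adjacent : IdentifiableMinusLeaves G ⊎ TriangleFree G → ⊥
        adjacent (inj₂ triangle-free) = ¬P4 (pendant-edge⇒IsoP4 u∈C v∈C uv
          (triangle-free⇒onlyCNeighbour triangle-free I uv)
          (triangle-free⇒onlyCNeighbour triangle-free I′ vu))
        adjacent (inj₁ identifiable) with isLeaf G u in leafu | isLeaf G v in leafv
        ... | true | _ = ¬P4 (pendant-edge⇒IsoP4 u∈C v∈C uv
          (leaf⇒onlyCNeighbour leafu uv) (twin-of-leaf⇒onlyCNeighbour leafu uv I))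
        ... | false | true = ¬P4 (pendant-edge⇒IsoP4 v∈C u∈C vu
          (leaf⇒onlyCNeighbour leafv vu) (twin-of-leaf⇒onlyCNeighbour leafv vu I′))
        ... | false | false = identifiable u v leafu leafv u≢v λ w nonLeaf → I w (nonLeaf∈C nonLeaf)

      C-separates : ∀ u v → u ≢ v → ¬ Indistinguishable C u v
      C-separates u v u≢v with C-or-selected u | C-or-selected v
      ... | inj₂ u∈ | _ = selected-distinguished u∈ u≢v
      ... | inj₁ _ | inj₂ v∈ = selected-distinguished v∈ (u≢v ∘ sym) ∘ Indistinguishable-sym
      ... | inj₁ u∈C | inj₁ v∈C = unselected-distinguished u∈C v∈C u≢v

      C-isTDIDCode : TDIDCode G C
      C-isTDIDCode =
        ((λ v → Product.map₂ (Product.map₂ inj₂) (C-total-domination v)) , C-separates) , C-total-domination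

lemma4 : ∀ (n : ℕ) (G : Graph n) → 4 ≤ n → Connected G → ¬ IsoP4 G →
    (IdentifiableMinusLeaves G ⊎ TriangleFree G) →
    ∃[ C ] (TDIDCode G C × ∣ C ∣ ≤ n ∸ s G)
lemma4 n G 4≤n conn ¬P4 hypothesis =
  C , C-isTDIDCode hypothesis ¬P4 ,
  ≤-trans (≤-reflexive (∣∁p∣≡n∸∣p∣ selected)) (∸-monoʳ-≤ n (s≤∣chosenLeaves∣ G))
  where
  open LeafComplement G conn 4≤n (chosenLeaves G)
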